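{- Let \(n>2\) and \(k\le n\) be positive integers. Then the map \[\Psi: \mathcal{N}_n(k) \to \bigcup_{d\mid n} \mathcal{A}_d(k),\qquad \Psi(S) = \left\langle \frac{1}{\gcd(L'(S))}\cdot L'(S) \right\rangle,\] is a well-defined bijection, where for a set \(B\) and rational \(r\), \(r\cdot B=\{rb: b\in B\}\), and \(\langle B\rangle\) is the submonoid of \(\mathbb{N}\) generated by \(B\).
   Context: A numerical semigroup is a submonoid \(S\) of \((\mathbb{N},+)\) (with \(\mathbb{N}=\{0,1,2,\dots\}\)) whose complement in \(\mathbb{N}\) is finite. Its primitives (minimal generators) form the unique smallest generating set \(P(S)\); the multiplicity \(m(S)\) is the smallest primitive and the maximum primitive is \(\max P(S)\) (for \(S=\mathbb{N}\), \(P(S)=\{1\}\)). The Frobenius number \(F(S)\) is the largest integer not in \(S\), and the conductor is \(c(S)=F(S)+1\). The depth of \(S\) is \(\lceil c(S)/m(S)\rceil\) and the primitive depth is \(\lceil \max P(S)/m(S)\rceil\). \(L(S)=\{s\in S: s<F(S)\}\) is the set of left elements (including \(0\)) and \(L'(S)=L(S)\cup\{F(S)\}\). \(\mathcal{N}_f(k)\) denotes the set of numerical semigroups with Frobenius number \(f\) and depth \(k\); \(\mathcal{A}_d(k)\) denotes the set of numerical semigroups with maximum primitive \(d\) and primitive depth \(k\); the union is over positive divisors \(d\) of \(n\). -}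

module Defs where

open import Data.Nat using (ℕ; zero; suc; _+_; _*_; _≤_; _<_)
open import Data.Nat.GCD using (gcd)
open import Data.Nat.Divisibility using (_∣_)
open import Data.Bool using (Bool; true)
open import Data.List using (List; foldr; filterᵇ; upTo; _++_; [_])
open import Data.List.Relation.Unary.Any using (Any)
open import Data.Product using (Σ; ∃; ∃-syntax; _×_)
open import Relation.Binary.PropositionalEquality using (_≡_)
open import Relation.Nullary using (¬_)

record NumericalSemigroup : Set where
  field
    mem      : ℕ → Bool
    has-zero : mem 0 ≡ true
    closed   : ∀ a b → mem a ≡ true → mem b ≡ true → mem (a + b) ≡ true
    cofinite : ∃[ c ] (∀ x → c ≤ x → mem x ≡ true)
open NumericalSemigroup public

infix 4 _∈S_
_∈S_ : ℕ → NumericalSemigroup → Set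
x ∈S S = mem S x ≡ true

_≈S_ : NumericalSemigroup → NumericalSemigroup → Set
S ≈S T = ∀ x → mem S x ≡ mem T x

IsFrobenius : NumericalSemigroup → ℕ → Set
IsFrobenius S f = ¬ (f ∈S S) × (∀ x → f < x → x ∈S S)

IsMultiplicity : NumericalSemigroup → ℕ → Set
IsMultiplicity S m = 0 < m × m ∈S S × (∀ x → 0 < x → x < m → ¬ (x ∈S S))

IsPrimitive : NumericalSemigroup → ℕ → Set
IsPrimitive S p = p ∈S S × 0 < p ×
  ¬ (Σ ℕ λ a → Σ ℕ λ b → 0 < a × 0 < b × a ∈S S × b ∈S S × a + b ≡ p)

IsMaxPrimitive : NumericalSemigroup → ℕ → Set
IsMaxPrimitive S d = IsPrimitive S d × (∀ p → IsPrimitive S p → p ≤ d)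

IsCeilDiv : ℕ → ℕ → ℕ → Set
IsCeilDiv a m k = a ≤ k * m × (∀ j → a ≤ j * m → k ≤ j)

-- S ∈ 𝒩_f(k): Frobenius number f and depth ⌈ c(S) / m(S) ⌉ = k, c(S) = f + 1.
InN : ℕ → ℕ → NumericalSemigroup → Set
InN f k S = IsFrobenius S f × (Σ ℕ λ m → IsMultiplicity S m × IsCeilDiv (suc f) m k)

InA : ℕ → ℕ → NumericalSemigroup → Set
InA d k T = IsMaxPrimitive T d × (Σ ℕ λ m → IsMultiplicity T m × IsCeilDiv d m k)

InUnionA : ℕ → ℕ → NumericalSemigroup → Set
InUnionA n k T = Σ ℕ λ d → 0 < d × d ∣ n × InA d k T

L′ : NumericalSemigroup → ℕ → List ℕ
L′ S f = filterᵇ (mem S) (upTo f) ++ [ f ]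

gcdList : List ℕ → ℕ
gcdList = foldr gcd 0

-- y ∈ (1/g)·B, i.e. y = b/g for some b ∈ B, where g = gcd(L'(S)).
ScaledL′ : NumericalSemigroup → ℕ → ℕ → Set
ScaledL′ S f y = Any (λ b → y * gcdList (L′ S f) ≡ b) (L′ S f)

data Gen (B : ℕ → Set) : ℕ → Set where
  gen-zero : Gen B 0
  gen-add  : ∀ {b x} → B b → Gen B x → Gen B (b + x)

IsΨ : ℕ → NumericalSemigroup → NumericalSemigroup → Set
IsΨ f S T = ∀ x → (x ∈S T → Gen (ScaledL′ S f) x) × (Gen (ScaledL′ S f) x → x ∈S T)

{-# OPTIONS --safe #-}
-- Let g = gcd L′(S) and n = d g. Every element of S below n is a multiple of g, so
-- Ψ(S) = ⟨L′(S) / g⟩ agrees with S / g below d, contains d, and d does not split there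
-- (that would put n in S); as Ψ(S) is generated by elements ≤ d, d is its maximal
-- primitive. Bézout applied to L′(S) / g, whose gcd is 1, makes Ψ(S) cofinite.
-- Conversely, for T with maximal primitive d ∣ n and e = n / d, the set
-- e · (T ∩ [0, d)) ∪ (n, ∞) is closed under addition because d is primitive; its L′ is
-- e · (T ∩ [0, d]), whose gcd is e as T is generated by its primitives ≤ d and contains
-- two consecutive integers. Multiplicities scale by g (resp. e), and the depths agree
-- because ⌈(n + 1) / m⌉ = ⌈n / m⌉ when m ∤ n. Injectivity: T determines d as its
-- maximal primitive, hence g = n / d, hence S below n as g · T.
module Submission where

open import Defs
open import Data.Nat
  using (ℕ; zero; suc; _+_; _*_; _∸_; _≤_; _<_; z≤n; s≤s; z<s; _≟_; _<?_; NonZero; >-nonZero)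
open import Data.Nat.Properties
open import Data.Nat.GCD using (gcd; gcd[m,n]∣m; gcd[m,n]∣n; gcd-greatest; gcd-GCD; module Bézout)
open import Data.Nat.Divisibility
  using (_∣_; divides; _∣0; quotient; ∣-antisym; ∣-trans; ∣-refl; _∣?_; ∣m∣n⇒∣m+n; ∣m+n∣m⇒∣n)
open import Data.Nat.DivMod using (_/_; _%_; m≡m%n+[m/n]*n; m%n<n; /-monoˡ-≤; m*n/n≡m)
open import Data.Nat.Induction using (<-rec)
open import Data.Bool using (Bool; true; false; T?)
open import Data.Bool.Properties using (T-≡)
import Data.Bool.Properties as Bool
open import Data.Fin using (toℕ; fromℕ<)
open import Data.Fin.Properties using (toℕ<n; toℕ-fromℕ<; any?)
open import Data.List using (List; []; _∷_; upTo; filterᵇ)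
open import Data.List.Membership.Propositional using (_∈_)
open import Data.List.Membership.Propositional.Properties
  using (∈-++⁺ˡ; ∈-++⁺ʳ; ∈-++⁻; ∈-filter⁺; ∈-filter⁻; ∈-upTo⁺; ∈-upTo⁻)
open import Data.List.Membership.DecPropositional _≟_ using (_∈?_)
open import Data.List.Relation.Unary.Any using (here; there)
open import Data.Product using (Σ; ∃; ∃-syntax; _×_; _,_; proj₁; proj₂)
open import Data.Sum using (_⊎_; inj₁; inj₂)
open import Data.Empty using (⊥-elim)
open import Function using (_∘_; _⇔_; mk⇔; Equivalence)
open import Function.Properties.Equivalence using () renaming (sym to ⇔-sym)
open import Relation.Binary.PropositionalEquality
open import Relation.Binary.Definitions using (tri<; tri≈; tri>)
open import Relation.Nullary using (¬_; Dec; yes; no; does; contradiction)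
open import Relation.Nullary.Decidable using (dec-true; map′; _×-dec_; _⊎-dec_)
open import Relation.Unary using (Decidable)
open import Data.Nat.Tactic.RingSolver using (solve-∀)

private
  variable
    a b c m p x y : ℕ
    B C : ℕ → Set

dec-true⁻ : ∀ {A : Set} (a? : Dec A) → does a? ≡ true → A
dec-true⁻ (yes a) _ = a

true⇔true⇒≡ : ∀ {u v : Bool} → (u ≡ true → v ≡ true) → (v ≡ true → u ≡ true) → u ≡ v
true⇔true⇒≡ {false} {false} _ _ = refl
true⇔true⇒≡ {false} {true}  _ f = f refl
true⇔true⇒≡ {true}  {false} t _ = sym (t refl)
true⇔true⇒≡ {true}  {true}  _ _ = refl

-- Generated submonoids

Gen-+ : Gen B a → Gen B b → Gen B (a + b)
Gen-+ gen-zero gb = gb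
Gen-+ {b = b} (gen-add {b = c} {x = x} Bc gx) gb =
  subst (Gen _) (sym (+-assoc c x b)) (gen-add Bc (Gen-+ gx gb))

Gen-singleton : B b → Gen B b
Gen-singleton {b = b} Bb = subst (Gen _) (+-identityʳ b) (gen-add Bb gen-zero)

Gen-* : ∀ j → Gen B a → Gen B (j * a)
Gen-* zero    ga = gen-zero
Gen-* (suc j) ga = Gen-+ ga (Gen-* j ga)

Gen-map : (∀ {y} → B y → C y) → Gen B x → Gen C x
Gen-map f gen-zero       = gen-zero
Gen-map f (gen-add By g) = gen-add (f By) (Gen-map f g)

Gen-ind : (P : ℕ → Set) → P 0 → (∀ a b → P a → P b → P (a + b)) →
          (∀ {b} → B b → P b) → Gen B x → P x
Gen-ind P P0 P+ B⇒P gen-zero       = P0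
Gen-ind P P0 P+ B⇒P (gen-add By g) = P+ _ _ (B⇒P By) (Gen-ind P P0 P+ B⇒P g)

Gen-pos : Gen B y → 0 < y → ∃[ b ] b < y × B (suc b) × Gen B (y ∸ suc b)
Gen-pos (gen-add {b = zero} _ g) y>0 = Gen-pos g y>0
Gen-pos (gen-add {b = suc b} {x = x} Bb g) _ =
  b , s≤s (m≤m+n b x) , Bb , subst (Gen _) (sym (m+n∸m≡n b x)) g

Gen? : Decidable B → Decidable (Gen B)
Gen? {B} B? = <-rec (λ x → Dec (Gen B x)) step
  where
  step : ∀ x → (∀ {z} → z < x → Dec (Gen B z)) → Dec (Gen B x)
  step zero    _   = yes gen-zero
  step (suc x) rec =
    map′ from to (any? λ i → B? (suc (toℕ i)) ×-dec rec (s≤s (m∸n≤m x (toℕ i))))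
    where
    from : ∃[ i ] B (suc (toℕ i)) × Gen B (x ∸ toℕ i) → Gen B (suc x)
    from (i , Bi , g) = subst (Gen B) (cong suc (m+[n∸m]≡n (≤-pred (toℕ<n i)))) (gen-add Bi g)
    to : Gen B (suc x) → ∃[ i ] B (suc (toℕ i)) × Gen B (x ∸ toℕ i)
    to g with b , b<1+x , Bb , g′ ← Gen-pos g z<s =
      fromℕ< b<1+x , subst (λ i → B (suc i) × Gen B (x ∸ i)) (sym (toℕ-fromℕ< b<1+x)) (Bb , g′)

-- Gaps and Bézout

gcdList-∣ : ∀ {xs} → b ∈ xs → gcdList xs ∣ b
gcdList-∣ {xs = x ∷ xs} (here refl) = gcd[m,n]∣m x (gcdList xs)
gcdList-∣ {xs = x ∷ xs} (there b∈) = ∣-trans (gcd[m,n]∣n x (gcdList xs)) (gcdList-∣ b∈)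

gcdList-greatest : ∀ xs → (∀ {b} → b ∈ xs → c ∣ b) → c ∣ gcdList xs
gcdList-greatest []       _ = divides 0 refl
gcdList-greatest (x ∷ xs) h = gcd-greatest (h (here refl)) (gcdList-greatest xs (h ∘ there))

HasGap : (ℕ → Set) → ℕ → Set
HasGap B a = ∃[ N ] Gen B N × Gen B (N + a)

gap-singleton : B b → HasGap B b
gap-singleton Bb = 0 , gen-zero , Gen-singleton Bb

gap-* : ∀ j → HasGap B a → HasGap B (j * a)
gap-* {a = a} j (N , gN , gN+a) = j * N , Gen-* j gN , subst (Gen _) (*-distribˡ-+ j N a) (Gen-* j gN+a)

gap-cancel : HasGap B (a + c) → HasGap B a → HasGap B c
gap-cancel {a = a} {c = c} (N₁ , g₁ , g₁′) (N₂ , g₂ , g₂′) =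
  N₁ + (N₂ + a) , Gen-+ g₁ g₂′ , subst (Gen _) (shift N₁ N₂ a c) (Gen-+ g₁′ g₂)
  where
  shift : ∀ N₁ N₂ a c → N₁ + (a + c) + N₂ ≡ N₁ + (N₂ + a) + c
  shift = solve-∀

gap-gcd : HasGap B a → HasGap B b → HasGap B (gcd a b)
gap-gcd {a = a} {b = b} ga gb with Bézout.identity (gcd-GCD a b)
... | Bézout.+- x y eq =
  gap-cancel (subst (HasGap _) (trans (sym eq) (+-comm _ (y * b))) (gap-* x ga)) (gap-* y gb)
... | Bézout.-+ x y eq =
  gap-cancel (subst (HasGap _) (trans (sym eq) (+-comm _ (x * a))) (gap-* y gb)) (gap-* x ga)

gap-gcdList : ∀ xs → (∀ {b} → b ∈ xs → B b) → HasGap B (gcdList xs)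
gap-gcdList []       _ = 0 , gen-zero , gen-zero
gap-gcdList (x ∷ xs) h = gap-gcd (gap-singleton (h (here refl))) (gap-gcdList xs (h ∘ there))

Gen-divide : ∀ {q} → (∀ {b} → B b → q ∣ b) → Gen B x →
             ∃[ y ] x ≡ y * q × Gen (λ y → B (y * q)) y
Gen-divide B⇒∣ gen-zero = 0 , refl , gen-zero
Gen-divide {B = B} {q = q} B⇒∣ (gen-add {b = b} Bb gx)
  with divides b₀ b≡ ← B⇒∣ Bb | y , x≡ , gy ← Gen-divide B⇒∣ gx =
  b₀ + y , trans (cong₂ _+_ b≡ x≡) (sym (*-distribʳ-+ q b₀ y)) , gen-add (subst B b≡ Bb) gy

gap-divide : ∀ {q} .{{_ : NonZero q}} → (∀ {b} → B b → q ∣ b) →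
             HasGap B q → HasGap (λ y → B (y * q)) 1
gap-divide {q = q} B⇒∣ (N , gN , gN+q)
  with N₀ , N≡ , gN₀ ← Gen-divide B⇒∣ gN | P₀ , P≡ , gP₀ ← Gen-divide B⇒∣ gN+q =
  N₀ , gN₀ , subst (Gen _) P₀≡N₀+1 gP₀
  where
  P₀≡N₀+1 : P₀ ≡ N₀ + 1
  P₀≡N₀+1 = *-cancelʳ-≡ P₀ (N₀ + 1) q (begin
    P₀ * q             ≡⟨ sym P≡ ⟩
    N + q              ≡⟨ cong₂ _+_ N≡ (sym (*-identityˡ q)) ⟩
    N₀ * q + 1 * q     ≡⟨ sym (*-distribʳ-+ q N₀ 1) ⟩
    (N₀ + 1) * q       ∎)
    where open ≡-Reasoning

-- Write y = q N + r with r < N ≤ q; then y = (q ∸ r) N + r (N + 1).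
gap-one⇒cofinite : HasGap B 1 → ∃[ c ] ∀ y → c ≤ y → Gen B y
gap-one⇒cofinite (zero , _ , g1) = 0 , λ y _ → subst (Gen _) (*-identityʳ y) (Gen-* y g1)
gap-one⇒cofinite {B = B} (N@(suc _) , gN , gN+1) = N * N , λ y N*N≤y →
  subst (Gen B) (decompose y N*N≤y) (Gen-+ (Gen-* (y / N ∸ y % N) gN) (Gen-* (y % N) gN+1))
  where
  decompose : ∀ y → N * N ≤ y → (y / N ∸ y % N) * N + y % N * (N + 1) ≡ y
  decompose y N*N≤y = begin
    (q ∸ r) * N + r * (N + 1) ≡⟨ regroup (q ∸ r) r N ⟩
    (q ∸ r + r) * N + r       ≡⟨ cong (λ z → z * N + r) (m∸n+n≡m r≤q) ⟩
    q * N + r                 ≡⟨ +-comm (q * N) r ⟩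
    r + q * N                 ≡⟨ sym (m≡m%n+[m/n]*n y N) ⟩
    y                         ∎
    where
    open ≡-Reasoning
    q = y / N
    r = y % N
    r≤q : r ≤ q
    r≤q = ≤-trans (<⇒≤ (m%n<n y N)) (subst (_≤ q) (m*n/n≡m N N) (/-monoˡ-≤ N N*N≤y))
    regroup : ∀ u r N → u * N + r * (N + 1) ≡ (u + r) * N + r
    regroup = solve-∀

-- Numerical semigroups and their primitives

_∈S?_ : ∀ x S → Dec (x ∈S S)
x ∈S? S = mem S x Bool.≟ true

frobenius-pos : ∀ {S f} → IsFrobenius S f → 0 < f
frobenius-pos {S} (f∉S , _) = n≢0⇒n>0 λ { refl → f∉S (has-zero S) }

∈S-* : ∀ S j → m ∈S S → j * m ∈S S
∈S-* S zero    mS = has-zero S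
∈S-* S (suc j) mS = closed S _ _ mS (∈S-* S j mS)

Gen-⊆ : ∀ {T} → (∀ {y} → B y → y ∈S T) → Gen B x → x ∈S T
Gen-⊆ {T = T} = Gen-ind (_∈S T) (has-zero T) (closed T)

-- IsΨ f S T unfolds to Generates (ScaledL′ S f) T.
Generates : (ℕ → Set) → NumericalSemigroup → Set
Generates B T = ∀ x → (x ∈S T → Gen B x) × (Gen B x → x ∈S T)

generated : Decidable B → HasGap B 1 → NumericalSemigroup
generated B? gap = record
  { mem      = λ x → does (Gen? B? x)
  ; has-zero = dec-true (Gen? B? 0) gen-zero
  ; closed   = λ a b a∈ b∈ → dec-true (Gen? B? (a + b))
                 (Gen-+ (dec-true⁻ (Gen? B? a) a∈) (dec-true⁻ (Gen? B? b) b∈))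
  ; cofinite = let c , ≥c⇒Gen = gap-one⇒cofinite gap in
               c , λ x c≤x → dec-true (Gen? B? x) (≥c⇒Gen x c≤x)
  }

generated-generates : (B? : Decidable B) (gap : HasGap B 1) → Generates B (generated B? gap)
generated-generates B? gap x = dec-true⁻ (Gen? B? x) , dec-true (Gen? B? x)

Splits : NumericalSemigroup → ℕ → Set
Splits T p = Σ ℕ λ a → Σ ℕ λ b → 0 < a × 0 < b × a ∈S T × b ∈S T × a + b ≡ p

splits? : ∀ T p → Dec (Splits T p)
splits? T p = map′ from to (any? λ i → (0 <? toℕ i) ×-dec (toℕ i ∈S? T) ×-dec ((p ∸ toℕ i) ∈S? T))
  where
  from : ∃[ i ] 0 < toℕ i × toℕ i ∈S T × (p ∸ toℕ i) ∈S T → Splits T p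
  from (i , a>0 , aT , bT) =
    toℕ i , p ∸ toℕ i , a>0 , m<n⇒0<n∸m (toℕ<n i) , aT , bT , m+[n∸m]≡n (<⇒≤ (toℕ<n i))
  to : Splits T p → ∃[ i ] 0 < toℕ i × toℕ i ∈S T × (p ∸ toℕ i) ∈S T
  to (a , b , a>0 , b>0 , aT , bT , refl) =
    fromℕ< a<p , subst (λ i → 0 < i × i ∈S T × (a + b ∸ i) ∈S T) (sym (toℕ-fromℕ< a<p))
                       (a>0 , aT , subst (_∈S T) (sym (m+n∸m≡n a b)) bT)
    where
    a<p : a < a + b
    a<p = m<m+n a b>0

Gen-primitives : ∀ T → x ∈S T → Gen (IsPrimitive T) x
Gen-primitives {x} T = <-rec (λ x → x ∈S T → Gen (IsPrimitive T) x) step x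
  where
  step : ∀ x → (∀ {z} → z < x → z ∈S T → Gen (IsPrimitive T) z) → x ∈S T → Gen (IsPrimitive T) x
  step zero _ _ = gen-zero
  step (suc x) rec xT with splits? T (suc x)
  ... | yes (a , b , a>0 , b>0 , aT , bT , a+b≡x) =
    subst (Gen _) a+b≡x (Gen-+ (rec (subst (a <_) a+b≡x (m<m+n a b>0)) aT)
                                (rec (subst (b <_) a+b≡x (m<n+m b a>0)) bT))
  ... | no ¬split = Gen-singleton (xT , z<s , ¬split)

primitive-generator : ∀ {T} → Generates B T → IsPrimitive T p → B p
primitive-generator {B = B} {T = T} gen (pT , p>0 , ¬split) = go (proj₁ (gen _) pT) p>0 ¬split
  where
  go : Gen B p → 0 < p → ¬ Splits T p → B p
  go (gen-add {b = zero} _ g)                 p>0 ¬split = go g p>0 ¬split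
  go (gen-add {b = suc b} {x = zero} Bb _)    _   _      = subst B (sym (+-identityʳ (suc b))) Bb
  go (gen-add {b = suc b} {x = suc x} Bb g)   _   ¬split =
    ⊥-elim (¬split (suc b , suc x , z<s , z<s , proj₂ (gen _) (Gen-singleton Bb) , proj₂ (gen _) g ,
                    refl))

primitive-≢-multiple : ∀ {T} → IsPrimitive T p → 0 < m → m ∈S T → m < p → ∀ j → j * m ≢ p
primitive-≢-multiple (_ , p>0 , _)      _   _  _   zero          = <⇒≢ p>0
primitive-≢-multiple _                  _   _  m<p (suc zero)    = <⇒≢ m<p ∘ trans (sym (+-identityʳ _))
primitive-≢-multiple {m = m} {T} (_ , _ , ¬split) m>0 mT _ (suc (suc j)) j*m≡p =
  ¬split (m , suc j * m , m>0 , ≤-trans m>0 (m≤m+n m (j * m)) , mT , ∈S-* T (suc j) mT , j*m≡p)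

maxPrimitive-unique : ∀ {T d d′} → IsMaxPrimitive T d → IsMaxPrimitive T d′ → d ≡ d′
maxPrimitive-unique (d-prim , ≤d) (d′-prim , ≤d′) = ≤-antisym (≤d′ _ d-prim) (≤d _ d′-prim)

multiplicity-≤ : ∀ {T} → IsMultiplicity T m → x ∈S T → 0 < x → m ≤ x
multiplicity-≤ (_ , _ , min) xT x>0 = ≮⇒≥ λ x<m → min _ x>0 x<m xT

multiplicity-one : ∀ {T} → 1 ∈S T → IsMultiplicity T 1
multiplicity-one 1∈T = z<s , 1∈T , λ x x>0 x<1 _ → <⇒≱ x<1 x>0

-- Ceiling quotients

*-pos⁻ : ∀ a b → 0 < a * b → 0 < a × 0 < b
*-pos⁻ a b ab>0 = n≢0⇒n>0 (λ { refl → <-irrefl refl ab>0 })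
                , n≢0⇒n>0 (λ { refl → <⇒≢ ab>0 (sym (*-zeroʳ a)) })

ceilDiv-unique : ∀ {a m k k′} → IsCeilDiv a m k → IsCeilDiv a m k′ → k ≡ k′
ceilDiv-unique (le , least) (le′ , least′) = ≤-antisym (least _ le′) (least′ _ le)

ceilDiv-one : 0 < a → a ≤ m → IsCeilDiv a m 1
ceilDiv-one {m = m} a>0 a≤m = ≤-trans a≤m (≤-reflexive (sym (*-identityˡ m))) , λ where
  zero    a≤0 → contradiction a≤0 (<⇒≱ a>0)
  (suc _) _   → s≤s z≤n

ceilDiv-cong : ∀ {a b m m′ k} → (∀ j → a ≤ j * m ⇔ b ≤ j * m′) →
               IsCeilDiv a m k → IsCeilDiv b m′ k
ceilDiv-cong {k = k} a⇔b (le , least) =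
  Equivalence.to (a⇔b k) le , λ j → least j ∘ Equivalence.from (a⇔b j)

≤-*-scale⇔ : ∀ {q} j .{{_ : NonZero q}} → a ≤ j * m ⇔ a * q ≤ j * (m * q)
≤-*-scale⇔ {a} {m} {q} j = mk⇔
  (λ le → subst (a * q ≤_) (*-assoc j m q) (*-monoˡ-≤ q le))
  (λ le → *-cancelʳ-≤ a (j * m) q (subst (a * q ≤_) (sym (*-assoc j m q)) le))

≤-suc⇔ : ∀ j → j * m ≢ a → a ≤ j * m ⇔ suc a ≤ j * m
≤-suc⇔ j j*m≢a = mk⇔ (λ le → ≤∧≢⇒< le (≢-sym j*m≢a)) <⇒≤

ceilDiv-* : ∀ {q k} .{{_ : NonZero q}} → IsCeilDiv a m k → IsCeilDiv (a * q) (m * q) k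
ceilDiv-* = ceilDiv-cong λ j → ≤-*-scale⇔ j

ceilDiv-*-cancel : ∀ {q k} .{{_ : NonZero q}} → IsCeilDiv (a * q) (m * q) k → IsCeilDiv a m k
ceilDiv-*-cancel = ceilDiv-cong λ j → ⇔-sym (≤-*-scale⇔ j)

ceilDiv-suc : ∀ {k} → (∀ j → j * m ≢ a) → IsCeilDiv a m k → IsCeilDiv (suc a) m k
ceilDiv-suc ≢a = ceilDiv-cong λ j → ≤-suc⇔ j (≢a j)

ceilDiv-pred : ∀ {k} → (∀ j → j * m ≢ a) → IsCeilDiv (suc a) m k → IsCeilDiv a m k
ceilDiv-pred ≢a = ceilDiv-cong λ j → ⇔-sym (≤-suc⇔ j (≢a j))

∈-L′⁻ : ∀ {S f} → b ∈ L′ S f → (b < f × b ∈S S) ⊎ b ≡ f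
∈-L′⁻ {S = S} {f} b∈ with ∈-++⁻ (filterᵇ (mem S) (upTo f)) b∈
... | inj₁ b∈filter = let b<f , Tb = ∈-filter⁻ (T? ∘ mem S) b∈filter in
                      inj₁ (∈-upTo⁻ b<f , Equivalence.to T-≡ Tb)
... | inj₂ (here b≡f) = inj₂ b≡f

∈-L′⁺ : ∀ {S f} → (b < f × b ∈S S) ⊎ b ≡ f → b ∈ L′ S f
∈-L′⁺ {S = S} (inj₁ (b<f , bS)) =
  ∈-++⁺ˡ (∈-filter⁺ (T? ∘ mem S) (∈-upTo⁺ b<f) (Equivalence.from T-≡ bS))
∈-L′⁺ {S = S} {f} (inj₂ b≡f) = ∈-++⁺ʳ (filterᵇ (mem S) (upTo f)) (here b≡f)

-- The map Ψ

module Image (S : NumericalSemigroup) {n : ℕ} (frob : IsFrobenius S n) where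

  L : List ℕ
  L = L′ S n

  g : ℕ
  g = gcdList L

  n∈L : n ∈ L
  n∈L = ∈-L′⁺ {S = S} (inj₂ refl)

  d : ℕ
  d = quotient (gcdList-∣ n∈L)

  n≡d*g : n ≡ d * g
  n≡d*g = _∣_.equality (gcdList-∣ n∈L)

  d>0×g>0 : 0 < d × 0 < g
  d>0×g>0 = *-pos⁻ d g (subst (0 <_) n≡d*g (frobenius-pos {S = S} frob))

  d>0 : 0 < d
  d>0 = proj₁ d>0×g>0

  instance
    g≢0 : NonZero g
    g≢0 = >-nonZero (proj₂ d>0×g>0)

  Scaled : ℕ → Set
  Scaled = ScaledL′ S n

  scaled≤d : Scaled y → y ≤ d
  scaled≤d {y} y*g∈L = *-cancelʳ-≤ y d g (subst (y * g ≤_) n≡d*g (≤n (∈-L′⁻ {S = S} y*g∈L)))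
    where
    ≤n : (y * g < n × y * g ∈S S) ⊎ y * g ≡ n → y * g ≤ n
    ≤n (inj₁ (lt , _)) = <⇒≤ lt
    ≤n (inj₂ eq)       = ≤-reflexive eq

  Gen-scaled⇒∈S : Gen Scaled y → y * g < n → y * g ∈S S
  Gen-scaled⇒∈S = Gen-ind Below (λ _ → has-zero S) add (λ {b} → generator {b})
    where
    Below : ℕ → Set
    Below y = y * g < n → y * g ∈S S
    add : ∀ a b → Below a → Below b → Below (a + b)
    add a b a∈ b∈ lt = subst (_∈S S) (sym (*-distribʳ-+ g a b))
      (closed S _ _ (a∈ (≤-<-trans (m≤m+n (a * g) (b * g)) lt′))
                    (b∈ (≤-<-trans (m≤n+m (b * g) (a * g)) lt′)))
      where
      lt′ : a * g + b * g < n
      lt′ = subst (_< n) (*-distribʳ-+ g a b) lt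
    generator : ∀ {b} → Scaled b → b * g < n → b * g ∈S S
    generator b*g∈L lt with ∈-L′⁻ {S = S} b*g∈L
    ... | inj₁ (_ , b*g∈S) = b*g∈S
    ... | inj₂ b*g≡n       = contradiction b*g≡n (<⇒≢ lt)

  Scaled? : Decidable Scaled
  Scaled? y = y * g ∈? L

  Scaled-gap : HasGap Scaled 1
  Scaled-gap = gap-divide gcdList-∣ (gap-gcdList L (λ b∈ → b∈))

  Ψ : NumericalSemigroup
  Ψ = generated Scaled? Scaled-gap

  Ψ-generates : IsΨ n S Ψ
  Ψ-generates = generated-generates Scaled? Scaled-gap

  module _ (T : NumericalSemigroup) (ψ : IsΨ n S T) where

    scaled⇒∈T : Scaled y → y ∈S T
    scaled⇒∈T {y} y*g∈L = proj₂ (ψ y) (Gen-singleton y*g∈L)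

    ∈T⇒∈S : y ∈S T → y * g < n → y * g ∈S S
    ∈T⇒∈S {y} yT = Gen-scaled⇒∈S (proj₁ (ψ y) yT)

    ∈S⇒∈T : x ∈S S → x < n → ∃[ y ] y * g ≡ x × y ∈S T
    ∈S⇒∈T xS x<n =
      let x∈L = ∈-L′⁺ {S = S} (inj₁ (x<n , xS)); divides y x≡y*g = gcdList-∣ x∈L in
      y , sym x≡y*g , scaled⇒∈T (subst (_∈ L) x≡y*g x∈L)

    d-maxPrimitive : IsMaxPrimitive T d
    d-maxPrimitive = (d∈T , d>0 , ¬split) , λ p p-prim → scaled≤d (primitive-generator {T = T} ψ p-prim)
      where
      d∈T : d ∈S T
      d∈T = scaled⇒∈T (∈-L′⁺ {S = S} (inj₂ (sym n≡d*g)))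
      ¬split : ¬ Splits T d
      ¬split (a , b , a>0 , b>0 , aT , bT , a+b≡d) =
        proj₁ frob (subst (_∈S S) sum (closed S _ _ (∈T⇒∈S aT a*g<n) (∈T⇒∈S bT b*g<n)))
        where
        sum : a * g + b * g ≡ n
        sum = trans (sym (*-distribʳ-+ g a b)) (trans (cong (_* g) a+b≡d) (sym n≡d*g))
        a*g<n : a * g < n
        a*g<n = subst (a * g <_) sum (m<m+n (a * g) (*-monoˡ-< g b>0))
        b*g<n : b * g < n
        b*g<n = subst (b * g <_) (trans (+-comm (b * g) (a * g)) sum) (m<m+n (b * g) (*-monoˡ-< g a>0))

    multiplicity-below : ∀ {k} → IsMultiplicity S m → m < n → IsCeilDiv (suc n) m k →
                         ∃[ m₀ ] IsMultiplicity T m₀ × IsCeilDiv d m₀ k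
    multiplicity-below {m} {k} (m>0 , mS , m-min) m<n ceil
      with m₀ , m₀*g≡m , m₀T ← ∈S⇒∈T mS m<n =
      m₀ , (m₀>0 , m₀T , m₀-min) ,
      ceilDiv-*-cancel (subst₂ (λ a b → IsCeilDiv a b k) n≡d*g (sym m₀*g≡m) (ceilDiv-pred j*m≢n ceil))
      where
      m₀>0 : 0 < m₀
      m₀>0 = proj₁ (*-pos⁻ m₀ g (subst (0 <_) (sym m₀*g≡m) m>0))
      m₀-min : ∀ x → 0 < x → x < m₀ → ¬ x ∈S T
      m₀-min x x>0 x<m₀ xT = m-min (x * g) (*-monoˡ-< g x>0) x*g<m (∈T⇒∈S xT (<-trans x*g<m m<n))
        where
        x*g<m : x * g < m
        x*g<m = subst (x * g <_) m₀*g≡m (*-monoˡ-< g x<m₀)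
      j*m≢n : ∀ j → j * m ≢ n
      j*m≢n j j*m≡n = proj₁ frob (subst (_∈S S) j*m≡n (∈S-* S j mS))

    -- If m(S) > F(S) then L′(S) = {0, F(S)}, so g = n and Ψ(S) = ℕ.
    multiplicity-above : ∀ {k} → IsMultiplicity S m → n < m → IsCeilDiv (suc n) m k →
                         IsMultiplicity T 1 × IsCeilDiv d 1 k
    multiplicity-above {m} {k} (_ , _ , m-min) n<m ceil =
      multiplicity-one {T = T} (subst (_∈S T) d≡1 (proj₁ (proj₁ d-maxPrimitive))) ,
      subst₂ (λ d k → IsCeilDiv d 1 k) (sym d≡1) (sym k≡1) (ceilDiv-one z<s ≤-refl)
      where
      n∣L : ∀ {b} → b ∈ L → n ∣ b
      n∣L {zero}  _   = n ∣0
      n∣L {suc b} b∈L with ∈-L′⁻ {S = S} b∈L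
      ... | inj₂ refl        = ∣-refl
      ... | inj₁ (b<n , bS)  = contradiction bS (m-min (suc b) z<s (<-trans b<n n<m))
      g≡n : g ≡ n
      g≡n = ∣-antisym (gcdList-∣ n∈L) (gcdList-greatest L n∣L)
      d≡1 : d ≡ 1
      d≡1 = *-cancelʳ-≡ d 1 g (trans (sym n≡d*g) (trans (sym g≡n) (sym (*-identityˡ g))))
      k≡1 : k ≡ 1
      k≡1 = ceilDiv-unique ceil (ceilDiv-one z<s n<m)

    Ψ-depth : ∀ {k} → InN n k S → ∃[ m₀ ] IsMultiplicity T m₀ × IsCeilDiv d m₀ k
    Ψ-depth (_ , m , m-S , ceil) with <-cmp m n
    ... | tri< m<n _ _ = multiplicity-below m-S m<n ceil
    ... | tri≈ _ m≡n _ = contradiction (subst (_∈S S) m≡n (proj₁ (proj₂ m-S))) (proj₁ frob)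
    ... | tri> _ _ n<m = 1 , multiplicity-above m-S n<m ceil

    Ψ-inUnionA : ∀ {k} → InN n k S → InUnionA n k T
    Ψ-inUnionA inN = d , d>0 , divides g (trans n≡d*g (*-comm d g)) , d-maxPrimitive , Ψ-depth inN

Ψ-transfer : ∀ S S′ T {n} (frob : IsFrobenius S n) (frob′ : IsFrobenius S′ n) →
             IsΨ n S T → IsΨ n S′ T → Image.g S frob ≡ Image.g S′ frob′ → x ∈S S → x ∈S S′
Ψ-transfer {x} S S′ T {n} frob frob′ ψ ψ′ g≡g′ xS with <-cmp x n
... | tri< x<n _ _ =
  let y , y*g≡x , yT = Image.∈S⇒∈T S frob T ψ xS x<n
      y*g′≡x = trans (cong (y *_) (sym g≡g′)) y*g≡x
  in subst (_∈S S′) y*g′≡x (Image.∈T⇒∈S S′ frob′ T ψ′ yT (subst (_< n) (sym y*g′≡x) x<n))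
... | tri≈ _ refl _ = contradiction xS (proj₁ frob)
... | tri> _ _ n<x  = proj₂ frob′ x n<x

Ψ-injective : ∀ S S′ T {n} → IsFrobenius S n → IsFrobenius S′ n →
              IsΨ n S T → IsΨ n S′ T → S ≈S S′
Ψ-injective S S′ T frob frob′ ψ ψ′ x =
  true⇔true⇒≡ (Ψ-transfer S S′ T frob frob′ ψ ψ′ g≡g′)
              (Ψ-transfer S′ S T frob′ frob ψ′ ψ (sym g≡g′))
  where
  module F  = Image S frob
  module F′ = Image S′ frob′
  d≡d′ : F.d ≡ F′.d
  d≡d′ = maxPrimitive-unique {T = T} (F.d-maxPrimitive T ψ) (F′.d-maxPrimitive T ψ′)
  g≡g′ : F.g ≡ F′.g
  g≡g′ = *-cancelˡ-≡ F.g F′.g F.d {{>-nonZero F.d>0}}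
           (trans (sym F.n≡d*g) (trans F′.n≡d*g (cong (_* F′.g) (sym d≡d′))))

-- The inverse of Ψ: Φ(T) = e · (T ∩ [0, d)) ∪ (n, ∞), where e = n / d

module Preimage (T : NumericalSemigroup) {n d : ℕ}
                (n>0 : 0 < n) (d∣n : d ∣ n) (d-max : IsMaxPrimitive T d) where

  e : ℕ
  e = quotient d∣n

  n≡d*e : n ≡ d * e
  n≡d*e = trans (_∣_.equality d∣n) (*-comm e d)

  d∈T : d ∈S T
  d∈T = proj₁ (proj₁ d-max)

  d>0 : 0 < d
  d>0 = proj₁ (proj₂ (proj₁ d-max))

  instance
    e≢0 : NonZero e
    e≢0 = >-nonZero (proj₂ (*-pos⁻ d e (subst (0 <_) n≡d*e n>0)))

  <d⇔*e<n : ∀ t → t < d ⇔ t * e < n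
  <d⇔*e<n t = mk⇔ (λ t<d → subst (t * e <_) (sym n≡d*e) (*-monoˡ-< e t<d))
                  (λ lt → *-cancelʳ-< e t d (subst (t * e <_) n≡d*e lt))

  ScaledT : ℕ → Set
  ScaledT x = ∃[ t ] t * e ≡ x × t ∈S T

  ScaledT? : Decidable ScaledT
  ScaledT? x with e ∣? x
  ... | no e∤x = no λ (t , t*e≡x , _) → e∤x (divides t (sym t*e≡x))
  ... | yes (divides q x≡q*e) = map′ (λ qT → q , sym x≡q*e , qT) from (q ∈S? T)
    where
    from : ScaledT x → q ∈S T
    from (t , t*e≡x , tT) = subst (_∈S T) (*-cancelʳ-≡ t q e (trans t*e≡x x≡q*e)) tT

  InΦ : ℕ → Set
  InΦ x = (x < n × ScaledT x) ⊎ n < x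

  InΦ? : Decidable InΦ
  InΦ? x = (x <? n ×-dec ScaledT? x) ⊎-dec (n <? x)

  -- Two elements of e · T below n cannot sum to n = d · e, because d is primitive.
  InΦ-+ : InΦ a → InΦ b → InΦ (a + b)
  InΦ-+ {a} {b} (inj₂ n<a) _          = inj₂ (≤-trans n<a (m≤m+n a b))
  InΦ-+ {a} {b} (inj₁ _)   (inj₂ n<b) = inj₂ (≤-trans n<b (m≤n+m b a))
  InΦ-+ {a} {b} (inj₁ (a<n , t₁ , t₁*e≡a , t₁T)) (inj₁ (b<n , t₂ , t₂*e≡b , t₂T))
    with <-cmp (a + b) n
  ... | tri< lt _ _ = inj₁ (lt , t₁ + t₂ , trans (*-distribʳ-+ e t₁ t₂) (cong₂ _+_ t₁*e≡a t₂*e≡b) ,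
                            closed T _ _ t₁T t₂T)
  ... | tri> _ _ gt = inj₂ gt
  ... | tri≈ _ a+b≡n _ =
    contradiction (t₁ , t₂ , t₁>0 , t₂>0 , t₁T , t₂T , t₁+t₂≡d) (proj₂ (proj₂ (proj₁ d-max)))
    where
    t₁+t₂≡d : t₁ + t₂ ≡ d
    t₁+t₂≡d = *-cancelʳ-≡ (t₁ + t₂) d e
      (trans (*-distribʳ-+ e t₁ t₂) (trans (cong₂ _+_ t₁*e≡a t₂*e≡b) (trans a+b≡n n≡d*e)))
    t₁<d : t₁ < d
    t₁<d = Equivalence.from (<d⇔*e<n t₁) (subst (_< n) (sym t₁*e≡a) a<n)
    t₂<d : t₂ < d
    t₂<d = Equivalence.from (<d⇔*e<n t₂) (subst (_< n) (sym t₂*e≡b) b<n)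
    t₁>0 : 0 < t₁
    t₁>0 = n≢0⇒n>0 λ t₁≡0 → <-irrefl (trans (cong (_+ t₂) (sym t₁≡0)) t₁+t₂≡d) t₂<d
    t₂>0 : 0 < t₂
    t₂>0 = n≢0⇒n>0 λ t₂≡0 →
      <-irrefl (trans (sym (+-identityʳ t₁)) (trans (cong (t₁ +_) (sym t₂≡0)) t₁+t₂≡d)) t₁<d

  Φ : NumericalSemigroup
  Φ = record
    { mem      = λ x → does (InΦ? x)
    ; has-zero = dec-true (InΦ? 0) (inj₁ (n>0 , 0 , refl , has-zero T))
    ; closed   = λ a b a∈ b∈ → dec-true (InΦ? (a + b))
                   (InΦ-+ (dec-true⁻ (InΦ? a) a∈) (dec-true⁻ (InΦ? b) b∈))
    ; cofinite = suc n , λ x n<x → dec-true (InΦ? x) (inj₂ n<x)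
    }

  ∈Φ-below : x ∈S Φ → x < n → ScaledT x
  ∈Φ-below {x} x∈Φ x<n with dec-true⁻ (InΦ? x) x∈Φ
  ... | inj₁ (_ , x∈eT) = x∈eT
  ... | inj₂ n<x        = contradiction n<x (<-asym x<n)

  Φ-frobenius : IsFrobenius Φ n
  Φ-frobenius = n∉Φ ∘ dec-true⁻ (InΦ? n) , λ x n<x → dec-true (InΦ? x) (inj₂ n<x)
    where
    n∉Φ : ¬ InΦ n
    n∉Φ (inj₁ (n<n , _)) = <-irrefl refl n<n
    n∉Φ (inj₂ n<n)       = <-irrefl refl n<n

  *e∈L′⇔ : ∀ t → t * e ∈ L′ Φ n ⇔ (t ∈S T × t ≤ d)
  *e∈L′⇔ t = mk⇔ to from
    where
    to : t * e ∈ L′ Φ n → t ∈S T × t ≤ d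
    to t*e∈L with ∈-L′⁻ {S = Φ} t*e∈L
    ... | inj₁ (t*e<n , t*e∈Φ) =
      let t′ , t′*e≡t*e , t′T = ∈Φ-below t*e∈Φ t*e<n in
      subst (_∈S T) (*-cancelʳ-≡ t′ t e t′*e≡t*e) t′T , <⇒≤ (Equivalence.from (<d⇔*e<n t) t*e<n)
    ... | inj₂ t*e≡n =
      let t≡d = *-cancelʳ-≡ t d e (trans t*e≡n n≡d*e) in
      subst (_∈S T) (sym t≡d) d∈T , ≤-reflexive t≡d
    from : t ∈S T × t ≤ d → t * e ∈ L′ Φ n
    from (tT , t≤d) with m≤n⇒m<n∨m≡n t≤d
    ... | inj₁ t<d = let t*e<n = Equivalence.to (<d⇔*e<n t) t<d in
                     ∈-L′⁺ {S = Φ} (inj₁ (t*e<n , dec-true (InΦ? _) (inj₁ (t*e<n , t , refl , tT))))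
    ... | inj₂ refl = ∈-L′⁺ {S = Φ} (inj₂ (sym n≡d*e))

  -- g ∣ e because g divides t · e for every t ∈ T, in particular for two consecutive t.
  gcd-L′≡e : gcdList (L′ Φ n) ≡ e
  gcd-L′≡e = ∣-antisym g∣e (gcdList-greatest (L′ Φ n) e∣L′)
    where
    g = gcdList (L′ Φ n)
    e∣L′ : ∀ {b} → b ∈ L′ Φ n → e ∣ b
    e∣L′ b∈L with ∈-L′⁻ {S = Φ} b∈L
    ... | inj₁ (b<n , b∈Φ) = let t , t*e≡b , _ = ∈Φ-below b∈Φ b<n in divides t (sym t*e≡b)
    ... | inj₂ refl        = divides d n≡d*e
    g∣T*e : ∀ {t} → t ∈S T → g ∣ t * e
    g∣T*e tT = Gen-ind (λ t → g ∣ t * e) (g ∣0) add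
      (λ p-prim → gcdList-∣ (Equivalence.from (*e∈L′⇔ _) (proj₁ p-prim , proj₂ d-max _ p-prim)))
      (Gen-primitives T tT)
      where
      add : ∀ a b → g ∣ a * e → g ∣ b * e → g ∣ (a + b) * e
      add a b ga gb = subst (g ∣_) (sym (*-distribʳ-+ e a b)) (∣m∣n⇒∣m+n ga gb)
    g∣e : g ∣ e
    g∣e = let c , ≥c⇒∈T = cofinite T in
      ∣m+n∣m⇒∣n (subst (g ∣_) (+-comm e (c * e)) (g∣T*e (≥c⇒∈T (suc c) (n≤1+n c))))
                (g∣T*e (≥c⇒∈T c ≤-refl))

  Φ-generates : IsΨ n Φ T
  Φ-generates x =
    (λ xT → Gen-map (λ p-prim → Equivalence.from (scaled⇔ _) (proj₁ p-prim , proj₂ d-max _ p-prim))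
                    (Gen-primitives T xT)) ,
    Gen-⊆ {T = T} (λ s → proj₁ (Equivalence.to (scaled⇔ _) s))
    where
    scaled⇔ : ∀ y → ScaledL′ Φ n y ⇔ (y ∈S T × y ≤ d)
    scaled⇔ y = subst (λ g → y * g ∈ L′ Φ n ⇔ (y ∈S T × y ≤ d)) (sym gcd-L′≡e) (*e∈L′⇔ y)

  Φ-multiplicity-below : ∀ {m k} → IsMultiplicity T m → m < d → IsCeilDiv d m k →
                         IsMultiplicity Φ (m * e) × IsCeilDiv (suc n) (m * e) k
  Φ-multiplicity-below {m} {k} (m>0 , mT , m-min) m<d ceil =
    (*-monoˡ-< e m>0 , dec-true (InΦ? _) (inj₁ (m*e<n , m , refl , mT)) , m*e-min) ,
    ceilDiv-suc j*m*e≢n (subst (λ a → IsCeilDiv a (m * e) k) (sym n≡d*e) (ceilDiv-* ceil))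
    where
    m*e<n : m * e < n
    m*e<n = Equivalence.to (<d⇔*e<n m) m<d
    m*e-min : ∀ x → 0 < x → x < m * e → ¬ x ∈S Φ
    m*e-min x x>0 x<m*e x∈Φ =
      let t , t*e≡x , tT = ∈Φ-below x∈Φ (<-trans x<m*e m*e<n) in
      m-min t (proj₁ (*-pos⁻ t e (subst (0 <_) (sym t*e≡x) x>0)))
              (*-cancelʳ-< e t m (subst (_< m * e) (sym t*e≡x) x<m*e)) tT
    j*m*e≢n : ∀ j → j * (m * e) ≢ n
    j*m*e≢n j eq = primitive-≢-multiple {T = T} (proj₁ d-max) m>0 mT m<d j
                     (*-cancelʳ-≡ (j * m) d e (trans (*-assoc j m e) (trans eq n≡d*e)))

  Φ-multiplicity-equal : ∀ {k} → IsMultiplicity T d → IsCeilDiv d d k →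
                         IsMultiplicity Φ (suc n) × IsCeilDiv (suc n) (suc n) k
  Φ-multiplicity-equal {k} d-T ceil =
    (z<s , dec-true (InΦ? _) (inj₂ ≤-refl) , n+1-min) ,
    subst (IsCeilDiv (suc n) (suc n)) (sym k≡1) (ceilDiv-one z<s ≤-refl)
    where
    k≡1 : k ≡ 1
    k≡1 = ceilDiv-unique ceil (ceilDiv-one d>0 ≤-refl)
    n+1-min : ∀ x → 0 < x → x < suc n → ¬ x ∈S Φ
    n+1-min x x>0 x<1+n x∈Φ with m<1+n⇒m<n∨m≡n x<1+n
    ... | inj₂ refl = proj₁ Φ-frobenius x∈Φ
    ... | inj₁ x<n  =
      let t , t*e≡x , tT = ∈Φ-below x∈Φ x<n in
      <⇒≱ (Equivalence.from (<d⇔*e<n t) (subst (_< n) (sym t*e≡x) x<n))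
          (multiplicity-≤ {T = T} d-T tT (proj₁ (*-pos⁻ t e (subst (0 <_) (sym t*e≡x) x>0))))

  Φ-inN : ∀ {k} → (∃[ m ] IsMultiplicity T m × IsCeilDiv d m k) → InN n k Φ
  Φ-inN (m , m-T , ceil) with m≤n⇒m<n∨m≡n (multiplicity-≤ {T = T} m-T d∈T d>0)
  ... | inj₁ m<d  = Φ-frobenius , m * e , Φ-multiplicity-below m-T m<d ceil
  ... | inj₂ refl = Φ-frobenius , suc n , Φ-multiplicity-equal m-T ceil

lemma5p2 : (n k : ℕ) → 2 < n → 0 < k → k ≤ n →
    ((S : NumericalSemigroup) → InN n k S →
       Σ NumericalSemigroup λ T → InUnionA n k T × IsΨ n S T)
    × ((S S′ T : NumericalSemigroup) → InN n k S → InN n k S′ →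
       IsΨ n S T → IsΨ n S′ T → S ≈S S′)
    × ((T : NumericalSemigroup) → InUnionA n k T →
       Σ NumericalSemigroup λ S → InN n k S × IsΨ n S T)
lemma5p2 n k 2<n _ _ =
  (λ S inN → let open Image S (proj₁ inN) in Ψ , Ψ-inUnionA Ψ Ψ-generates inN , Ψ-generates) ,
  (λ S S′ T (frob , _) (frob′ , _) → Ψ-injective S S′ T frob frob′) ,
  (λ T (d , _ , d∣n , d-max , depth) →
     let open Preimage T (<-trans z<s 2<n) d∣n d-max in Φ , Φ-inN depth , Φ-generates)
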